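{- Let $\Theta=t_1^{T_1},\dots,t_n^{T_n}$ be an atomic context and let $\Theta_i:=t_{i1}^{T_1},\dots,t_{in}^{T_n}$ for $i=1,2$ be clones of $\Theta$ (with $2n$ distinct fresh variables). Then $\Theta_1,\Theta_2\le^a\Theta$.
   Context: Simply typed $\lambda$-calculus over base type $0$; every type is uniquely $[B_1,\dots,B_m]:=B_1\to\cdots\to B_m\to0$; $1:=[0]$. A context is a finite list of distinct typed variables, $\{\Gamma\}$ its set; terms identified up to $\beta\eta$ ($=_{\beta\eta}$); $\Lambda^\Xi(A)$ = terms of type $A$ with free variables in $\{\Xi\}$. A substitution $\varrho$ from $\Gamma$ to $\Delta$ assigns $\varrho_c\in\Lambda^\Delta(C)$ to each $c^C\in\{\Gamma\}$; for a fresh context $\Xi$, $\varrho^\Xi$ is $\varrho$ on $\{\Gamma\}$ and the identity on $\{\Xi\}$. $\varrho$ is an atomic reduction if for every fresh $\Xi$, all $a^A,b^B\in\{\Xi,\Gamma\}$ with $A\equiv[A_1,\dots,A_n]$, $B\equiv[B_1,\dots,B_m]$, and all $M_i\in\Lambda^{\Xi,\Delta}(A_i)$, $N_i\in\Lambda^{\Xi,\Delta}(B_i)$: $\varrho^\Xi_aM_1\cdots M_n=_{\beta\eta}\varrho^\Xi_bN_1\cdots N_m$ implies $a=b$ and all $M_i=N_i$. $\Gamma\le^a\Delta$ means such a reduction exists. A context $\Theta$ is atomic if $f_1^1,f_2^1\le^a\Theta$ for two distinct variables $f_1,f_2$ of type $1$. -}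

module Defs where

open import Data.List using (List; []; _∷_; _++_)
open import Data.List.Relation.Unary.All using (All; []; _∷_)
open import Data.List.Relation.Unary.Any using (here; there)
open import Data.List.Membership.Propositional using (_∈_)
open import Data.Product using (Σ; ∃; _×_; _,_)
open import Relation.Binary.PropositionalEquality using (_≡_; refl)

-- Types: every type is uniquely [B₁,…,Bₘ] := B₁ → ⋯ → Bₘ → 0.
data Ty : Set where
  ty : List Ty → Ty

args : Ty → List Ty
args (ty As) = As

o : Ty
o = ty []

ι : Ty
ι = ty (o ∷ [])

-- Contexts: lists of types; variables are positions (de Bruijn), hence
-- automatically distinct.  Ctx Ξ ++ Γ plays the role of "Ξ,Γ".
Ctx : Set
Ctx = List Ty

data Tm (Γ : Ctx) : Ty → Set where
  var : ∀ {A} → A ∈ Γ → Tm Γ A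
  app : ∀ {A As} → Tm Γ (ty (A ∷ As)) → Tm Γ A → Tm Γ (ty As)
  lam : ∀ {A As} → Tm (A ∷ Γ) (ty As) → Tm Γ (ty (A ∷ As))

Ren : Ctx → Ctx → Set
Ren Γ Δ = ∀ {A} → A ∈ Γ → A ∈ Δ

extR : ∀ {Γ Δ B} → Ren Γ Δ → Ren (B ∷ Γ) (B ∷ Δ)
extR ρ (here p) = here p
extR ρ (there x) = there (ρ x)

rename : ∀ {Γ Δ A} → Ren Γ Δ → Tm Γ A → Tm Δ A
rename ρ (var x) = var (ρ x)
rename ρ (app M N) = app (rename ρ M) (rename ρ N)
rename ρ (lam M) = lam (rename (extR ρ) M)

Sub : Ctx → Ctx → Set
Sub Γ Δ = ∀ {C} → C ∈ Γ → Tm Δ C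

exts : ∀ {Γ Δ B} → Sub Γ Δ → Sub (B ∷ Γ) (B ∷ Δ)
exts σ (here p) = var (here p)
exts σ (there x) = rename there (σ x)

sub : ∀ {Γ Δ A} → Sub Γ Δ → Tm Γ A → Tm Δ A
sub σ (var x) = σ x
sub σ (app M N) = app (sub σ M) (sub σ N)
sub σ (lam M) = lam (sub (exts σ) M)

single : ∀ {Γ B} → Tm Γ B → Sub (B ∷ Γ) Γ
single N (here refl) = N
single N (there x) = var x

_[_] : ∀ {Γ A B} → Tm (B ∷ Γ) A → Tm Γ B → Tm Γ A
M [ N ] = sub (single N) M

infix 4 _=βη_
data _=βη_ {Γ : Ctx} : ∀ {A} → Tm Γ A → Tm Γ A → Set where
  refl≈  : ∀ {A} {M : Tm Γ A} → M =βη M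
  sym≈   : ∀ {A} {M N : Tm Γ A} → M =βη N → N =βη M
  trans≈ : ∀ {A} {M N P : Tm Γ A} → M =βη N → N =βη P → M =βη P
  app≈   : ∀ {A As} {M M′ : Tm Γ (ty (A ∷ As))} {N N′ : Tm Γ A} →
           M =βη M′ → N =βη N′ → app M N =βη app M′ N′
  lam≈   : ∀ {A As} {M M′ : Tm (A ∷ Γ) (ty As)} →
           M =βη M′ → lam M =βη lam M′
  β      : ∀ {A As} (M : Tm (A ∷ Γ) (ty As)) (N : Tm Γ A) →
           app (lam M) N =βη M [ N ]
  η      : ∀ {A As} (M : Tm Γ (ty (A ∷ As))) →
           M =βη lam (app (rename there M) (var (here refl)))

apps : ∀ {Γ A} → Tm Γ A → All (Tm Γ) (args A) → Tm Γ o
apps {A = ty []} M [] = M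
apps {A = ty (B ∷ Bs)} M (N ∷ Ns) = apps (app M N) Ns

data ArgsEq {Γ : Ctx} : ∀ {As} → All (Tm Γ) As → All (Tm Γ) As → Set where
  []  : ArgsEq [] []
  _∷_ : ∀ {A As} {M N : Tm Γ A} {Ms Ns : All (Tm Γ) As} →
        M =βη N → ArgsEq Ms Ns → ArgsEq (M ∷ Ms) (N ∷ Ns)

data SameHead {Θ Δ : Ctx} : ∀ {A B} → A ∈ Θ → All (Tm Δ) (args A) →
                                 B ∈ Θ → All (Tm Δ) (args B) → Set where
  same : ∀ {A} {a : A ∈ Θ} {Ms Ns : All (Tm Δ) (args A)} →
         ArgsEq Ms Ns → SameHead a Ms a Ns

extSub : ∀ {Γ Δ} (Ξ : Ctx) → Sub Γ Δ → Sub (Ξ ++ Γ) (Ξ ++ Δ)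
extSub [] ϱ = ϱ
extSub (B ∷ Ξ) ϱ = exts (extSub Ξ ϱ)

IsAtomicReduction : ∀ {Γ Δ} → Sub Γ Δ → Set
IsAtomicReduction {Γ} {Δ} ϱ =
  ∀ (Ξ : Ctx) {A B} (a : A ∈ Ξ ++ Γ) (b : B ∈ Ξ ++ Γ)
    (Ms : All (Tm (Ξ ++ Δ)) (args A)) (Ns : All (Tm (Ξ ++ Δ)) (args B)) →
    apps (extSub Ξ ϱ a) Ms =βη apps (extSub Ξ ϱ b) Ns →
    SameHead a Ms b Ns

infix 4 _≤ᵃ_
_≤ᵃ_ : Ctx → Ctx → Set
Γ ≤ᵃ Δ = Σ (Sub Γ Δ) IsAtomicReduction

AtomicCtx : Ctx → Set
AtomicCtx Θ = (ι ∷ ι ∷ []) ≤ᵃ Θ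

-- Given an atomic reduction ϱ : f₁, f₂ ≤ᵃ Θ, send the two clones t₁ᵢ, t₂ᵢ of tᵢ
-- to λx̄. ϱ(f₁) (tᵢ x̄) and λx̄. ϱ(f₂) (tᵢ x̄).  After β-reduction, an equation
-- between two applied images becomes an equation between applied images of
-- f_k, f_l or of fresh variables under ϱ, so atomicity of ϱ gives k = l and
-- tᵢ M̄ =βη tⱼ N̄.  Atomicity of ϱ once more, now with the whole context taken as
-- fresh, yields i = j and M̄ =βη N̄.

module Submission where

open import Defs
open import Data.List using ([]; _∷_; _++_)
open import Data.List.Relation.Unary.All as All using (All; []; _∷_)
open import Data.List.Relation.Unary.Any using (here; there)
open import Data.List.Relation.Unary.Any.Properties using (++⁺ˡ; ++⁺ʳ; ++⁻; ++⁺∘++⁻; ++⁻∘++⁺)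
open import Data.List.Membership.Propositional using (_∈_)
open import Data.Product using (_,_)
open import Data.Sum using (_⊎_; inj₁; inj₂; [_,_]′)
open import Data.Sum.Properties using (inj₁-injective; inj₂-injective)
open import Data.Empty using (⊥; ⊥-elim)
open import Function using (id)
open import Level using (0ℓ)
open import Relation.Binary.Bundles using (Setoid)
import Relation.Binary.Reasoning.Setoid as SetoidReasoning
open import Relation.Binary.PropositionalEquality
  using (_≡_; _≢_; refl; sym; trans; cong; cong₂; subst; subst₂; module ≡-Reasoning)

≡⇒=βη : ∀ {Γ A} {M N : Tm Γ A} → M ≡ N → M =βη N
≡⇒=βη refl = refl≈

=βη-setoid : Ctx → Ty → Setoid 0ℓ 0ℓ
=βη-setoid Γ A = record
  { Carrier = Tm Γ A
  ; _≈_ = _=βη_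
  ; isEquivalence = record { refl = refl≈ ; sym = sym≈ ; trans = trans≈ }
  }

module =βη-Reasoning {Γ A} = SetoidReasoning (=βη-setoid Γ A)

rename-rename : ∀ {Γ Δ Ε A} {ρ₁ : Ren Γ Δ} {ρ₂ : Ren Δ Ε} {ρ : Ren Γ Ε} →
  (∀ {B} (x : B ∈ Γ) → ρ₂ (ρ₁ x) ≡ ρ x) → (M : Tm Γ A) →
  rename ρ₂ (rename ρ₁ M) ≡ rename ρ M
rename-rename h (var x) = cong var (h x)
rename-rename h (app M N) = cong₂ app (rename-rename h M) (rename-rename h N)
rename-rename {ρ₁ = ρ₁} {ρ₂} {ρ} h (lam M) = cong lam (rename-rename h′ M)
  where
  h′ : ∀ {B} (x : B ∈ _) → extR ρ₂ (extR ρ₁ x) ≡ extR ρ x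
  h′ (here p) = refl
  h′ (there x) = cong there (h x)

rename-id : ∀ {Γ A} {ρ : Ren Γ Γ} → (∀ {B} (x : B ∈ Γ) → ρ x ≡ x) → (M : Tm Γ A) →
  rename ρ M ≡ M
rename-id h (var x) = cong var (h x)
rename-id h (app M N) = cong₂ app (rename-id h M) (rename-id h N)
rename-id {ρ = ρ} h (lam M) = cong lam (rename-id h′ M)
  where
  h′ : ∀ {B} (x : B ∈ _) → extR ρ x ≡ x
  h′ (here p) = refl
  h′ (there x) = cong there (h x)

sub-rename : ∀ {Γ Δ Ε A} {ρ : Ren Γ Δ} {σ : Sub Δ Ε} {τ : Sub Γ Ε} →
  (∀ {B} (x : B ∈ Γ) → σ (ρ x) ≡ τ x) → (M : Tm Γ A) →
  sub σ (rename ρ M) ≡ sub τ M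
sub-rename h (var x) = h x
sub-rename h (app M N) = cong₂ app (sub-rename h M) (sub-rename h N)
sub-rename {ρ = ρ} {σ} {τ} h (lam M) = cong lam (sub-rename h′ M)
  where
  h′ : ∀ {B} (x : B ∈ _) → exts σ (extR ρ x) ≡ exts τ x
  h′ (here p) = refl
  h′ (there x) = cong (rename there) (h x)

rename-extR-there : ∀ {Γ Δ A C} {ρ : Ren Γ Δ} (M : Tm Γ A) →
  rename (extR {B = C} ρ) (rename there M) ≡ rename there (rename ρ M)
rename-extR-there M = trans (rename-rename (λ _ → refl) M) (sym (rename-rename (λ _ → refl) M))

rename-sub : ∀ {Γ Δ Ε A} {σ : Sub Γ Δ} {ρ : Ren Δ Ε} {τ : Sub Γ Ε} →
  (∀ {B} (x : B ∈ Γ) → rename ρ (σ x) ≡ τ x) → (M : Tm Γ A) →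
  rename ρ (sub σ M) ≡ sub τ M
rename-sub h (var x) = h x
rename-sub h (app M N) = cong₂ app (rename-sub h M) (rename-sub h N)
rename-sub {σ = σ} {ρ} {τ} h (lam M) = cong lam (rename-sub h′ M)
  where
  h′ : ∀ {B} (x : B ∈ _) → rename (extR ρ) (exts σ x) ≡ exts τ x
  h′ (here p) = refl
  h′ (there x) = trans (rename-extR-there (σ x)) (cong (rename there) (h x))

sub-id : ∀ {Γ A} {σ : Sub Γ Γ} → (∀ {B} (x : B ∈ Γ) → σ x ≡ var x) → (M : Tm Γ A) →
  sub σ M ≡ M
sub-id h (var x) = h x
sub-id h (app M N) = cong₂ app (sub-id h M) (sub-id h N)
sub-id {σ = σ} h (lam M) = cong lam (sub-id h′ M)
  where
  h′ : ∀ {B} (x : B ∈ _) → exts σ x ≡ var x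
  h′ (here p) = refl
  h′ (there x) = cong (rename there) (h x)

sub-exts-there : ∀ {Γ Δ A C} {σ : Sub Γ Δ} (M : Tm Γ A) →
  sub (exts {B = C} σ) (rename there M) ≡ rename there (sub σ M)
sub-exts-there M = trans (sub-rename (λ _ → refl) M) (sym (rename-sub (λ _ → refl) M))

rename-there-[] : ∀ {Γ A B} (M : Tm Γ A) (N : Tm Γ B) → rename there M [ N ] ≡ M
rename-there-[] M N = trans (sub-rename {τ = var} (λ _ → refl) M) (sub-id (λ _ → refl) M)

rename-[] : ∀ {Γ Δ A B} (ρ : Ren Γ Δ) (M : Tm (B ∷ Γ) A) (N : Tm Γ B) →
  rename ρ (M [ N ]) ≡ rename (extR ρ) M [ rename ρ N ]
rename-[] ρ M N = trans (rename-sub h M) (sym (sub-rename (λ _ → refl) M))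
  where
  h : ∀ {C} (x : C ∈ _) → rename ρ (single N x) ≡ single (rename ρ N) (extR ρ x)
  h (here refl) = refl
  h (there x) = refl

rename-=βη : ∀ {Γ Δ A} (ρ : Ren Γ Δ) {M N : Tm Γ A} → M =βη N → rename ρ M =βη rename ρ N
rename-=βη ρ refl≈ = refl≈
rename-=βη ρ (sym≈ e) = sym≈ (rename-=βη ρ e)
rename-=βη ρ (trans≈ e e′) = trans≈ (rename-=βη ρ e) (rename-=βη ρ e′)
rename-=βη ρ (app≈ e e′) = app≈ (rename-=βη ρ e) (rename-=βη ρ e′)
rename-=βη ρ (lam≈ e) = lam≈ (rename-=βη (extR ρ) e)
rename-=βη ρ (β M N) = trans≈ (β _ _) (≡⇒=βη (sym (rename-[] ρ M N)))
rename-=βη ρ (η M) = trans≈ (η (rename ρ M))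
  (≡⇒=βη (cong (λ X → lam (app X (var (here refl)))) (sym (rename-extR-there M))))

rename-=βη⁻ : ∀ {Γ Δ A} {ρ : Ren Γ Δ} (κ : Ren Δ Γ) → (∀ {B} (x : B ∈ Γ) → κ (ρ x) ≡ x) →
  {M N : Tm Γ A} → rename ρ M =βη rename ρ N → M =βη N
rename-=βη⁻ κ κ∘ρ≡id {M} {N} e = subst₂ _=βη_ (retract M) (retract N) (rename-=βη κ e)
  where
  retract : ∀ {A} (M : Tm _ A) → rename κ (rename _ M) ≡ M
  retract M = trans (rename-rename κ∘ρ≡id M) (rename-id (λ _ → refl) M)

rename-apps : ∀ {Γ Δ A} (ρ : Ren Γ Δ) (M : Tm Γ A) (Ms : All (Tm Γ) (args A)) →
  rename ρ (apps M Ms) ≡ apps (rename ρ M) (All.map (rename ρ) Ms)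
rename-apps {A = ty []} ρ M [] = refl
rename-apps {A = ty (B ∷ Bs)} ρ M (N ∷ Ns) = rename-apps ρ (app M N) Ns

apps-congˡ : ∀ {Γ A} {M M′ : Tm Γ A} (Ms : All (Tm Γ) (args A)) →
  M =βη M′ → apps M Ms =βη apps M′ Ms
apps-congˡ {A = ty []} [] e = e
apps-congˡ {A = ty (B ∷ Bs)} (N ∷ Ns) e = apps-congˡ Ns (app≈ e refl≈)

-- The η-long composite λx̄. W (M x̄).
postcompose : ∀ {Γ A} → Tm Γ ι → Tm Γ A → Tm Γ A
postcompose {A = ty []} W M = app W M
postcompose {A = ty (B ∷ Bs)} W M =
  lam (postcompose (rename there W) (app (rename there M) (var (here refl))))

rename-postcompose : ∀ {Γ Δ A} (ρ : Ren Γ Δ) (W : Tm Γ ι) (M : Tm Γ A) →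
  rename ρ (postcompose W M) ≡ postcompose (rename ρ W) (rename ρ M)
rename-postcompose {A = ty []} ρ W M = refl
rename-postcompose {A = ty (B ∷ Bs)} ρ W M = cong lam (trans (rename-postcompose (extR ρ) _ _)
  (cong₂ (λ X Y → postcompose X (app Y (var (here refl))))
         (rename-extR-there W) (rename-extR-there M)))

sub-postcompose : ∀ {Γ Δ A} (σ : Sub Γ Δ) (W : Tm Γ ι) (M : Tm Γ A) →
  sub σ (postcompose W M) ≡ postcompose (sub σ W) (sub σ M)
sub-postcompose {A = ty []} σ W M = refl
sub-postcompose {A = ty (B ∷ Bs)} σ W M = cong lam (trans (sub-postcompose (exts σ) _ _)
  (cong₂ (λ X Y → postcompose X (app Y (var (here refl))))
         (sub-exts-there W) (sub-exts-there M)))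

apps-postcompose : ∀ {Γ A} (W : Tm Γ ι) (M : Tm Γ A) (Ms : All (Tm Γ) (args A)) →
  apps (postcompose W M) Ms =βη app W (apps M Ms)
apps-postcompose {A = ty []} W M [] = refl≈
apps-postcompose {A = ty (B ∷ Bs)} W M (N ∷ Ns) = begin
  apps (app (postcompose W M) N) Ns
    ≈⟨ apps-congˡ Ns (β _ N) ⟩
  apps (sub (single N) (postcompose (rename there W) (app (rename there M) (var (here refl))))) Ns
    ≡⟨ cong (λ X → apps {A = ty Bs} X Ns) (sub-postcompose (single N) _ _) ⟩
  apps (postcompose (rename there W [ N ]) (app (rename there M [ N ]) N)) Ns
    ≡⟨ cong₂ (λ X Y → apps (postcompose X (app Y N)) Ns) (rename-there-[] W N) (rename-there-[] M N) ⟩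
  apps (postcompose W (app M N)) Ns
    ≈⟨ apps-postcompose W (app M N) Ns ⟩
  app W (apps (app M N) Ns) ∎
  where open =βη-Reasoning

module _ {A : Ty} (Ξ : Ctx) {Γ : Ctx} where

  ++⁻∘++⁺ˡ : (x : A ∈ Ξ) → ++⁻ Ξ {Γ} (++⁺ˡ x) ≡ inj₁ x
  ++⁻∘++⁺ˡ x = ++⁻∘++⁺ Ξ (inj₁ x)

  ++⁻∘++⁺ʳ : (y : A ∈ Γ) → ++⁻ Ξ (++⁺ʳ Ξ y) ≡ inj₂ y
  ++⁻∘++⁺ʳ y = ++⁻∘++⁺ Ξ (inj₂ y)

  ++⁺ˡ-injective : {x y : A ∈ Ξ} → ++⁺ˡ {ys = Γ} x ≡ ++⁺ˡ y → x ≡ y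
  ++⁺ˡ-injective {x} {y} eq = inj₁-injective (begin
    inj₁ x            ≡⟨ sym (++⁻∘++⁺ˡ x) ⟩
    ++⁻ Ξ (++⁺ˡ x)    ≡⟨ cong (++⁻ Ξ) eq ⟩
    ++⁻ Ξ (++⁺ˡ y)    ≡⟨ ++⁻∘++⁺ˡ y ⟩
    inj₁ y            ∎)
    where open ≡-Reasoning

  ++⁺ʳ-injective : {x y : A ∈ Γ} → ++⁺ʳ Ξ x ≡ ++⁺ʳ Ξ y → x ≡ y
  ++⁺ʳ-injective {x} {y} eq = inj₂-injective (begin
    inj₂ x              ≡⟨ sym (++⁻∘++⁺ʳ x) ⟩
    ++⁻ Ξ (++⁺ʳ Ξ x)    ≡⟨ cong (++⁻ Ξ) eq ⟩
    ++⁻ Ξ (++⁺ʳ Ξ y)    ≡⟨ ++⁻∘++⁺ʳ y ⟩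
    inj₂ y              ∎)
    where open ≡-Reasoning

  ++⁺ˡ≢++⁺ʳ : {x : A ∈ Ξ} {y : A ∈ Γ} → ++⁺ˡ x ≢ ++⁺ʳ Ξ y
  ++⁺ˡ≢++⁺ʳ {x} {y} eq with trans (sym (++⁻∘++⁺ˡ x)) (trans (cong (++⁻ Ξ) eq) (++⁻∘++⁺ʳ y))
  ... | ()

  data ++-View : A ∈ Ξ ++ Γ → Set where
    left  : (x : A ∈ Ξ) → ++-View (++⁺ˡ x)
    right : (y : A ∈ Γ) → ++-View (++⁺ʳ Ξ y)

  ++-view : (z : A ∈ Ξ ++ Γ) → ++-View z
  ++-view z = subst ++-View (++⁺∘++⁻ Ξ z) (fromSum (++⁻ Ξ z))
    where
    fromSum : (s : A ∈ Ξ ⊎ A ∈ Γ) → ++-View ([ ++⁺ˡ , ++⁺ʳ Ξ ]′ s)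
    fromSum (inj₁ x) = left x
    fromSum (inj₂ y) = right y

extSub-++⁺ˡ : ∀ Ξ {Γ Δ} (ϱ : Sub Γ Δ) {A} (x : A ∈ Ξ) → extSub Ξ ϱ (++⁺ˡ x) ≡ var (++⁺ˡ x)
extSub-++⁺ˡ (B ∷ Ξ) ϱ (here p) = refl
extSub-++⁺ˡ (B ∷ Ξ) ϱ (there x) = cong (rename there) (extSub-++⁺ˡ Ξ ϱ x)

extSub-++⁺ʳ : ∀ Ξ {Γ Δ} (ϱ : Sub Γ Δ) {A} (y : A ∈ Γ) →
  extSub Ξ ϱ (++⁺ʳ Ξ y) ≡ rename (++⁺ʳ Ξ) (ϱ y)
extSub-++⁺ʳ [] ϱ y = sym (rename-id (λ _ → refl) (ϱ y))
extSub-++⁺ʳ (B ∷ Ξ) ϱ y =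
  trans (cong (rename there) (extSub-++⁺ʳ Ξ ϱ y)) (rename-rename (λ _ → refl) (ϱ y))

ArgsEq-sym : ∀ {Γ As} {Ms Ns : All (Tm Γ) As} → ArgsEq Ms Ns → ArgsEq Ns Ms
ArgsEq-sym [] = []
ArgsEq-sym (e ∷ es) = sym≈ e ∷ ArgsEq-sym es

ArgsEq-rename⁻ : ∀ {Γ Δ As} {ρ : Ren Γ Δ} (κ : Ren Δ Γ) → (∀ {B} (x : B ∈ Γ) → κ (ρ x) ≡ x) →
  (Ms Ns : All (Tm Γ) As) → ArgsEq (All.map (rename ρ) Ms) (All.map (rename ρ) Ns) → ArgsEq Ms Ns
ArgsEq-rename⁻ κ inv [] [] [] = []
ArgsEq-rename⁻ κ inv (M ∷ Ms) (N ∷ Ns) (e ∷ es) = rename-=βη⁻ κ inv e ∷ ArgsEq-rename⁻ κ inv Ms Ns es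

module _ {X Δ : Ctx} where

  SameHead-sym : ∀ {A B} {a : A ∈ X} {b : B ∈ X}
    {Ms : All (Tm Δ) (args A)} {Ns : All (Tm Δ) (args B)} →
    SameHead a Ms b Ns → SameHead b Ns a Ms
  SameHead-sym (same es) = same (ArgsEq-sym es)

  SameHead-map : ∀ {Y} (f : Ren X Y) {A B} {x : A ∈ X} {y : B ∈ X}
    {Ms : All (Tm Δ) (args A)} {Ns : All (Tm Δ) (args B)} →
    SameHead x Ms y Ns → SameHead (f x) Ms (f y) Ns
  SameHead-map f (same es) = same es

  SameHead-map⁻ : ∀ {Y} (f : Ren X Y) → (∀ {A} {x y : A ∈ X} → f x ≡ f y → x ≡ y) →
    ∀ {A B} {x : A ∈ X} {y : B ∈ X}
    {Ms : All (Tm Δ) (args A)} {Ns : All (Tm Δ) (args B)} →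
    SameHead (f x) Ms (f y) Ns → SameHead x Ms y Ns
  SameHead-map⁻ f f-injective = reflect refl refl
    where
    reflect : ∀ {A B} {x : A ∈ X} {y : B ∈ X} {a : A ∈ _} {b : B ∈ _}
      {Ms : All (Tm Δ) (args A)} {Ns : All (Tm Δ) (args B)} →
      f x ≡ a → f y ≡ b → SameHead a Ms b Ns → SameHead x Ms y Ns
    reflect fx≡a fy≡b (same es) with f-injective (trans fx≡a (sym fy≡b))
    ... | refl = same es

  SameHead-rename⁻ : ∀ {Γ} {ρ : Ren Δ Γ} (κ : Ren Γ Δ) → (∀ {B} (x : B ∈ Δ) → κ (ρ x) ≡ x) →
    ∀ {A B} {x : A ∈ X} {y : B ∈ X} (Ms : All (Tm Δ) (args A)) (Ns : All (Tm Δ) (args B)) →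
    SameHead x (All.map (rename ρ) Ms) y (All.map (rename ρ) Ns) → SameHead x Ms y Ns
  SameHead-rename⁻ κ inv Ms Ns (same es) = same (ArgsEq-rename⁻ κ inv Ms Ns es)

SameHead-++⁺ˡ-++⁺ʳ : ∀ Ξ {Γ Δ A B} {x : A ∈ Ξ} {y : B ∈ Γ}
  {Ms : All (Tm Δ) (args A)} {Ns : All (Tm Δ) (args B)} →
  SameHead (++⁺ˡ x) Ms (++⁺ʳ Ξ y) Ns → ⊥
SameHead-++⁺ˡ-++⁺ʳ Ξ = disjoint refl refl
  where
  disjoint : ∀ {Γ Δ A B} {x : A ∈ Ξ} {y : B ∈ Γ} {a : A ∈ _} {b : B ∈ _}
    {Ms : All (Tm Δ) (args A)} {Ns : All (Tm Δ) (args B)} →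
    ++⁺ˡ x ≡ a → ++⁺ʳ Ξ y ≡ b → SameHead a Ms b Ns → ⊥
  disjoint x≡a y≡b (same es) = ++⁺ˡ≢++⁺ʳ Ξ (trans x≡a (sym y≡b))

-- Taking all of Ξ ++ Δ as the fresh context, on which ϱ acts as the identity,
-- atomicity of ϱ says in particular that variable heads are injective.
apps-var-injective : ∀ {Γ Δ} {ϱ : Sub Γ Δ} → IsAtomicReduction ϱ →
  ∀ Ξ {A B} {x : A ∈ Ξ ++ Δ} {y : B ∈ Ξ ++ Δ}
  (Ms : All (Tm (Ξ ++ Δ)) (args A)) (Ns : All (Tm (Ξ ++ Δ)) (args B)) →
  apps (var x) Ms =βη apps (var y) Ns → SameHead x Ms y Ns
apps-var-injective {Δ = Δ} {ϱ} ϱ-atomic Ξ {x = x} {y} Ms Ns eq =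
  SameHead-rename⁻ retract retract-++⁺ˡ Ms Ns
    (SameHead-map⁻ ++⁺ˡ (++⁺ˡ-injective (Ξ ++ Δ))
      (ϱ-atomic (Ξ ++ Δ) (++⁺ˡ x) (++⁺ˡ y) _ _
        (subst₂ _=βη_ (rename-++⁺ˡ-apps x Ms) (rename-++⁺ˡ-apps y Ns) (rename-=βη ++⁺ˡ eq))))
  where
  retract : Ren ((Ξ ++ Δ) ++ Δ) (Ξ ++ Δ)
  retract z = [ id , ++⁺ʳ Ξ ]′ (++⁻ (Ξ ++ Δ) z)

  retract-++⁺ˡ : ∀ {B} (z : B ∈ Ξ ++ Δ) → retract (++⁺ˡ z) ≡ z
  retract-++⁺ˡ z = cong [ id , ++⁺ʳ Ξ ]′ (++⁻∘++⁺ˡ (Ξ ++ Δ) z)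

  rename-++⁺ˡ-apps : ∀ {B} (z : B ∈ Ξ ++ Δ) (Ls : All (Tm (Ξ ++ Δ)) (args B)) →
    rename ++⁺ˡ (apps (var z) Ls) ≡ apps (extSub (Ξ ++ Δ) ϱ (++⁺ˡ z)) (All.map (rename ++⁺ˡ) Ls)
  rename-++⁺ˡ-apps z Ls = trans (rename-apps ++⁺ˡ (var z) Ls)
    (cong (λ X → apps X (All.map (rename ++⁺ˡ) Ls)) (sym (extSub-++⁺ˡ (Ξ ++ Δ) ϱ z)))

f₁ f₂ : ι ∈ ι ∷ ι ∷ []
f₁ = here refl
f₂ = there (here refl)

module MergeClones {Θ : Ctx} (ϱ : Sub (ι ∷ ι ∷ []) Θ) where

  copy : ι ∈ ι ∷ ι ∷ [] → Ren Θ (Θ ++ Θ)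
  copy (here _) = ++⁺ˡ
  copy (there (here _)) = ++⁺ʳ Θ

  mergeClones : Sub (Θ ++ Θ) Θ
  mergeClones z =
    [ (λ t → postcompose (ϱ f₁) (var t)) , (λ t → postcompose (ϱ f₂) (var t)) ]′ (++⁻ Θ z)

  mergeClones-copy : ∀ f {A} (t : A ∈ Θ) → mergeClones (copy f t) ≡ postcompose (ϱ f) (var t)
  mergeClones-copy (here refl) t =
    cong [ (λ t → postcompose (ϱ f₁) (var t)) , _ ]′ (++⁻∘++⁺ˡ Θ t)
  mergeClones-copy (there (here refl)) t =
    cong [ _ , (λ t → postcompose (ϱ f₂) (var t)) ]′ (++⁻∘++⁺ʳ Θ t)

  data HeadView (Ξ : Ctx) {A : Ty} : A ∈ Ξ ++ (Θ ++ Θ) → Set where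
    fresh : (x : A ∈ Ξ) → HeadView Ξ (++⁺ˡ x)
    clone : (f : ι ∈ ι ∷ ι ∷ []) (t : A ∈ Θ) → HeadView Ξ (++⁺ʳ Ξ (copy f t))

  headView : ∀ Ξ {A} (a : A ∈ Ξ ++ (Θ ++ Θ)) → HeadView Ξ a
  headView Ξ a with ++-view Ξ a
  ... | left x = fresh x
  ... | right y with ++-view Θ y
  ...   | left t = clone f₁ t
  ...   | right t = clone f₂ t

  module _ {Ξ : Ctx} where

    originType : ∀ {A} {a : A ∈ Ξ ++ (Θ ++ Θ)} → HeadView Ξ a → Ty
    originType {A} (fresh x) = A
    originType (clone f t) = ι

    origin : ∀ {A} {a : A ∈ Ξ ++ (Θ ++ Θ)} (v : HeadView Ξ a) → originType v ∈ Ξ ++ (ι ∷ ι ∷ [])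
    origin (fresh x) = ++⁺ˡ x
    origin (clone f t) = ++⁺ʳ Ξ f

    spine : ∀ {A} {a : A ∈ Ξ ++ (Θ ++ Θ)} (v : HeadView Ξ a) →
      All (Tm (Ξ ++ Θ)) (args A) → All (Tm (Ξ ++ Θ)) (args (originType v))
    spine (fresh x) Ms = Ms
    spine (clone f t) Ms = apps (var (++⁺ʳ Ξ t)) Ms ∷ []

    unfold : ∀ {A} {a : A ∈ Ξ ++ (Θ ++ Θ)} (v : HeadView Ξ a) (Ms : All (Tm (Ξ ++ Θ)) (args A)) →
      apps (extSub Ξ mergeClones a) Ms =βη apps (extSub Ξ ϱ (origin v)) (spine v Ms)
    unfold (fresh x) Ms = ≡⇒=βη (cong (λ X → apps X Ms)
      (trans (extSub-++⁺ˡ Ξ mergeClones x) (sym (extSub-++⁺ˡ Ξ ϱ x))))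
    unfold (clone f t) Ms = begin
      apps (extSub Ξ mergeClones (++⁺ʳ Ξ (copy f t))) Ms
        ≡⟨ cong (λ X → apps X Ms) (extSub-++⁺ʳ Ξ mergeClones (copy f t)) ⟩
      apps (rename (++⁺ʳ Ξ) (mergeClones (copy f t))) Ms
        ≡⟨ cong (λ X → apps (rename (++⁺ʳ Ξ) X) Ms) (mergeClones-copy f t) ⟩
      apps (rename (++⁺ʳ Ξ) (postcompose (ϱ f) (var t))) Ms
        ≡⟨ cong (λ X → apps X Ms) (rename-postcompose (++⁺ʳ Ξ) (ϱ f) (var t)) ⟩
      apps (postcompose (rename (++⁺ʳ Ξ) (ϱ f)) (var (++⁺ʳ Ξ t))) Ms
        ≈⟨ apps-postcompose (rename (++⁺ʳ Ξ) (ϱ f)) (var (++⁺ʳ Ξ t)) Ms ⟩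
      app (rename (++⁺ʳ Ξ) (ϱ f)) (apps (var (++⁺ʳ Ξ t)) Ms)
        ≡⟨ cong (λ X → app X (apps (var (++⁺ʳ Ξ t)) Ms)) (sym (extSub-++⁺ʳ Ξ ϱ f)) ⟩
      app (extSub Ξ ϱ (++⁺ʳ Ξ f)) (apps (var (++⁺ʳ Ξ t)) Ms) ∎
      where open =βη-Reasoning

    reflect : IsAtomicReduction ϱ →
      ∀ {A B} {a : A ∈ Ξ ++ (Θ ++ Θ)} {b : B ∈ Ξ ++ (Θ ++ Θ)} (v : HeadView Ξ a) (w : HeadView Ξ b)
      (Ms : All (Tm (Ξ ++ Θ)) (args A)) (Ns : All (Tm (Ξ ++ Θ)) (args B)) →
      SameHead (origin v) (spine v Ms) (origin w) (spine w Ns) → SameHead a Ms b Ns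
    reflect ϱ-atomic (fresh x) (fresh y) Ms Ns sh =
      SameHead-map ++⁺ˡ (SameHead-map⁻ ++⁺ˡ (++⁺ˡ-injective Ξ) sh)
    reflect ϱ-atomic (fresh x) (clone g u) Ms Ns sh = ⊥-elim (SameHead-++⁺ˡ-++⁺ʳ Ξ sh)
    reflect ϱ-atomic (clone f t) (fresh y) Ms Ns sh = ⊥-elim (SameHead-++⁺ˡ-++⁺ʳ Ξ (SameHead-sym sh))
    reflect ϱ-atomic (clone f t) (clone g u) Ms Ns sh
      with SameHead-map⁻ (++⁺ʳ Ξ) (++⁺ʳ-injective Ξ) sh
    ... | same (tMs≈uNs ∷ []) =
      SameHead-map (λ s → ++⁺ʳ Ξ (copy f s))
        (SameHead-map⁻ (++⁺ʳ Ξ) (++⁺ʳ-injective Ξ) (apps-var-injective ϱ-atomic Ξ Ms Ns tMs≈uNs))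

  mergeClones-atomic : IsAtomicReduction ϱ → IsAtomicReduction mergeClones
  mergeClones-atomic ϱ-atomic Ξ a b Ms Ns eq =
    reflect ϱ-atomic v w Ms Ns (ϱ-atomic Ξ (origin v) (origin w) (spine v Ms) (spine w Ns)
      (trans≈ (sym≈ (unfold v Ms)) (trans≈ eq (unfold w Ns))))
    where
    v = headView Ξ a
    w = headView Ξ b

mainTheorem17 : (Θ : Ctx) → AtomicCtx Θ → (Θ ++ Θ) ≤ᵃ Θ
mainTheorem17 Θ (ϱ , ϱ-atomic) = mergeClones , mergeClones-atomic ϱ-atomic
  where open MergeClones ϱ
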